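{- In three-pile Sharing Nim, for positive integers $a,b$, the position with pile sizes $(a,a,b)$ is an N-position.
   Context: Sharing Nim: a position is a triple of nonnegative integers (pile sizes). Two players alternate moves. A move is either (a) removing a positive number of objects from one pile, or (b) transferring a positive number of objects from one pile to another pile, subject to the restriction that objects may not be transferred from a pile of greater size to a pile of smaller size. The player who removes the last object wins (a player with no legal move loses). An N-position is a position from which the player about to move has a winning strategy; a P-position is one from which the player who just moved (i.e., the opponent of the player to move) has a winning strategy. -}

module Defs where

open import Data.Nat using (ℕ; _+_; _∸_; _≤_; _<_)
open import Data.Fin using (Fin; zero; suc)
open import Data.Product using (Σ; _×_; _,_; ∃)
open import Relation.Binary.PropositionalEquality using (_≡_)
open import Relation.Nullary using (¬_)

Position : Set
Position = Fin 3 → ℕ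

⟨_,_,_⟩ : ℕ → ℕ → ℕ → Position
⟨ x , y , z ⟩ zero = x
⟨ x , y , z ⟩ (suc zero) = y
⟨ x , y , z ⟩ (suc (suc zero)) = z

data Move (p q : Position) : Set where
  remove : (i : Fin 3) (k : ℕ) → 0 < k → k ≤ p i →
           q i ≡ p i ∸ k →
           (∀ j → ¬ (j ≡ i) → q j ≡ p j) →
           Move p q
  transfer : (i j : Fin 3) → ¬ (i ≡ j) → (k : ℕ) → 0 < k → k ≤ p i →
             p i ≤ p j →
             q i ≡ p i ∸ k → q j ≡ p j + k →
             (∀ l → ¬ (l ≡ i) → ¬ (l ≡ j) → q l ≡ p l) →
             Move p q

-- N-positions (player to move wins) and P-positions (player who just
-- moved wins), defined inductively: the game is finite (every transfer
-- strictly increases the sum of squares while preserving the total).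
data IsN (p : Position) : Set
data IsP (p : Position) : Set

data IsN p where
  win : (q : Position) → Move p q → IsP q → IsN p

data IsP p where
  lose : (∀ q → Move p q → IsN q) → IsP p

module Submission where

open import Defs
open import Data.Nat using (ℕ; _<_; _≤_; _∸_)
open import Data.Nat.Properties
  using (m<n⇒0<n∸m; m∸n≤m; m∸[m∸n]≡n; <⇒≤; ∸-monoʳ-<; m≤m+n; <-≤-trans; ≤-trans;
         ≤-reflexive; n≮n)
open import Data.Nat.Induction using (<-rec)
open import Data.Fin using (Fin; zero; suc)
open import Data.Product using (Σ-syntax; _×_; _,_)
open import Data.Empty using (⊥; ⊥-elim)
open import Relation.Binary.PropositionalEquality using (_≡_; _≢_; refl; sym; subst)

-- The second player wins (m, m, 0) by mirroring: whatever the first player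
-- does to one pile, the other pile is cut down to match it.  So (a, a, 0)
-- is a P-position, and (a, a, b) is won by emptying the third pile.

f₀ f₁ f₂ : Fin 3
f₀ = zero
f₁ = suc zero
f₂ = suc (suc zero)

twin : ℕ → Position
twin m = ⟨ m , m , 0 ⟩

removeDownTo : (p q : Position) (i : Fin 3) → q i < p i →
               (∀ j → j ≢ i → q j ≡ p j) → Move p q
removeDownTo p q i q<p same =
  remove i (p i ∸ q i) (m<n⇒0<n∸m q<p) (m∸n≤m (p i) (q i))
         (sym (m∸[m∸n]≡n (<⇒≤ q<p))) same

equalize-second : (q : Position) → q f₂ ≡ 0 → q f₀ < q f₁ → Move q (twin (q f₀))
equalize-second q empty lt = removeDownTo q (twin (q f₀)) f₁ lt same
  where
  same : ∀ j → j ≢ f₁ → twin (q f₀) j ≡ q j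
  same zero             _   = refl
  same (suc zero)       j≢j = ⊥-elim (j≢j refl)
  same (suc (suc zero)) _   = sym empty

equalize-first : (q : Position) → q f₂ ≡ 0 → q f₁ < q f₀ → Move q (twin (q f₁))
equalize-first q empty lt = removeDownTo q (twin (q f₁)) f₀ lt same
  where
  same : ∀ j → j ≢ f₀ → twin (q f₁) j ≡ q j
  same zero             j≢j = ⊥-elim (j≢j refl)
  same (suc zero)       _   = refl
  same (suc (suc zero)) _   = sym empty

MirrorReply : ℕ → Position → Set
MirrorReply m q = Σ[ m′ ∈ ℕ ] m′ < m × Move q (twin m′)

twin-mirror : ∀ {m q} → Move (twin m) q → MirrorReply m q
twin-mirror {m} {q} = reply
  where
  taken-from : ∀ {k} i → 0 < k → k ≤ m → q i ≡ m ∸ k → q i < m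
  taken-from {k} i 0<k k≤m eq = subst (_< m) (sym eq) (∸-monoʳ-< 0<k k≤m)

  nothing-to-take : ∀ {k} → 0 < k → k ≤ 0 → ⊥
  nothing-to-take 0<k k≤0 = n≮n 0 (<-≤-trans 0<k k≤0)

  reply-first : q f₂ ≡ 0 → q f₀ < m → m ≤ q f₁ → MirrorReply m q
  reply-first empty q₀<m m≤q₁ = q f₀ , q₀<m , equalize-second q empty (<-≤-trans q₀<m m≤q₁)

  reply-second : q f₂ ≡ 0 → q f₁ < m → m ≤ q f₀ → MirrorReply m q
  reply-second empty q₁<m m≤q₀ = q f₁ , q₁<m , equalize-first q empty (<-≤-trans q₁<m m≤q₀)

  reply : Move (twin m) q → MirrorReply m q
  reply (remove zero k 0<k k≤m eq same) =
    reply-first (same f₂ λ ()) (taken-from f₀ 0<k k≤m eq) (≤-reflexive (sym (same f₁ λ ())))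
  reply (remove (suc zero) k 0<k k≤m eq same) =
    reply-second (same f₂ λ ()) (taken-from f₁ 0<k k≤m eq) (≤-reflexive (sym (same f₀ λ ())))
  reply (remove (suc (suc zero)) k 0<k k≤0 _ _) = ⊥-elim (nothing-to-take 0<k k≤0)
  reply (transfer zero (suc zero) _ k 0<k k≤m _ eq₀ eq₁ same) =
    reply-first (same f₂ (λ ()) (λ ())) (taken-from f₀ 0<k k≤m eq₀)
                (subst (m ≤_) (sym eq₁) (m≤m+n m k))
  reply (transfer (suc zero) zero _ k 0<k k≤m _ eq₁ eq₀ same) =
    reply-second (same f₂ (λ ()) (λ ())) (taken-from f₁ 0<k k≤m eq₁)
                 (subst (m ≤_) (sym eq₀) (m≤m+n m k))
  reply (transfer zero (suc (suc zero)) _ k 0<k k≤m m≤0 _ _ _) =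
    ⊥-elim (nothing-to-take 0<k (≤-trans k≤m m≤0))
  reply (transfer (suc zero) (suc (suc zero)) _ k 0<k k≤m m≤0 _ _ _) =
    ⊥-elim (nothing-to-take 0<k (≤-trans k≤m m≤0))
  reply (transfer (suc (suc zero)) _ _ k 0<k k≤0 _ _ _ _) = ⊥-elim (nothing-to-take 0<k k≤0)
  reply (transfer zero zero i≢i _ _ _ _ _ _ _) = ⊥-elim (i≢i refl)
  reply (transfer (suc zero) (suc zero) i≢i _ _ _ _ _ _ _) = ⊥-elim (i≢i refl)

twin-isP : ∀ m → IsP (twin m)
twin-isP = <-rec (λ m → IsP (twin m)) step
  where
  step : ∀ m → (∀ {m′} → m′ < m → IsP (twin m′)) → IsP (twin m)
  step m ih = lose λ q move →
    let (m′ , m′<m , back) = twin-mirror move in win (twin m′) back (ih m′<m)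

lemma6p3 : (a b : ℕ) → 0 < a → 0 < b → IsN ⟨ a , a , b ⟩
lemma6p3 a b _ 0<b = win (twin a) emptyThird (twin-isP a)
  where
  same : ∀ j → j ≢ f₂ → twin a j ≡ ⟨ a , a , b ⟩ j
  same zero             _   = refl
  same (suc zero)       _   = refl
  same (suc (suc zero)) j≢j = ⊥-elim (j≢j refl)

  emptyThird : Move ⟨ a , a , b ⟩ (twin a)
  emptyThird = removeDownTo ⟨ a , a , b ⟩ (twin a) f₂ 0<b same
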